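{- For $p\in\mathbb N$ and $\alpha\in\mathbb K$, let $L_p\defeq e^{ -\hat xD^{p+1}}$ and $L^{(\alpha)}_p\defeq(1-pD^p)^\alpha L_p$. Then \[ L^{(\alpha)}_p=e^{ -\hat xD^{p+1}-\alpha pD^p}. \]
   Context: $\mathbb K$ is a field of characteristic zero; operators are linear maps on $\mathbb K[x]$; $\hat x$ is multiplication by $x$ and $D=d/dx$. Exponentials of operators are the exponential series; applied to a polynomial they are finite sums since the exponents lower the degree (for $p=0$ read $D^0=1$, so $pD^p=0$ and $e^{ -\hat xD}$ lowers... acts by $f(x)\mapsto f(x/e)$ on polynomials, the series being finite on each monomial). $(1-pD^p)^\alpha=\sum_{m\ge0}\binom{\alpha}{m}(-pD^p)^m$. -}

module Defs where

open import Level using (Level; _⊔_) renaming (suc to lsuc)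
open import Data.Nat using (ℕ; zero; suc)
open import Data.List using (List; []; _∷_; length)
open import Relation.Nullary using (¬_)
open import Algebra.Bundles using (CommutativeRing)

natR : ∀ {c ℓ} (R : CommutativeRing c ℓ) → ℕ → CommutativeRing.Carrier R
natR R zero    = CommutativeRing.0# R
natR R (suc n) = CommutativeRing._+_ R (CommutativeRing.1# R) (natR R n)

record CharZeroField (c ℓ : Level) : Set (lsuc (c ⊔ ℓ)) where
  field
    cring     : CommutativeRing c ℓ
  open CommutativeRing cring public
  field
    inv       : Carrier → Carrier
    1≉0       : ¬ (1# ≈ 0#)
    inv-right : ∀ x → ¬ (x ≈ 0#) → x * inv x ≈ 1#
    charZero  : ∀ n → ¬ (natR cring (suc n) ≈ 0#)

  natC : ℕ → Carrier
  natC = natR cring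

-- Polynomials K[x] (coefficient lists, constant term first) and linear
-- operators on them.
module Ops {c ℓ : Level} (K : CharZeroField c ℓ) where
  open CharZeroField K hiding (zero)

  Poly : Set c
  Poly = List Carrier

  coeff : Poly → ℕ → Carrier
  coeff []       _       = 0#
  coeff (a ∷ f)  zero    = a
  coeff (a ∷ f)  (suc i) = coeff f i

  -- equality of polynomials (coefficientwise, trailing zeros irrelevant)
  infix 4 _≈ₚ_
  _≈ₚ_ : Poly → Poly → Set ℓ
  f ≈ₚ g = ∀ i → coeff f i ≈ coeff g i

  Op : Set c
  Op = Poly → Poly

  _+ₚ_ : Poly → Poly → Poly
  []      +ₚ g       = g
  (a ∷ f) +ₚ []      = a ∷ f
  (a ∷ f) +ₚ (b ∷ g) = (a + b) ∷ (f +ₚ g)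

  _·ₚ_ : Carrier → Poly → Poly
  k ·ₚ []      = []
  k ·ₚ (a ∷ f) = (k * a) ∷ (k ·ₚ f)

  _⊕_ : Op → Op → Op
  (A ⊕ B) f = A f +ₚ B f

  scaleOp : Carrier → Op → Op
  scaleOp k A f = k ·ₚ A f

  negOp : Op → Op
  negOp A = scaleOp (- 1#) A

  _∘ₒ_ : Op → Op → Op
  (A ∘ₒ B) f = A (B f)

  idOp : Op
  idOp f = f

  powOp : Op → ℕ → Op
  powOp A zero    = idOp
  powOp A (suc k) = A ∘ₒ powOp A k

  xhat : Op
  xhat f = 0# ∷ f

  private
    derivFrom : ℕ → Poly → Poly
    derivFrom n []      = []
    derivFrom n (a ∷ f) = (natC n * a) ∷ derivFrom (suc n) f

  D : Op
  D []      = []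
  D (a ∷ f) = derivFrom 1 f

  factC : ℕ → Carrier
  factC zero    = 1#
  factC (suc k) = natC (suc k) * factC k

  sumTo : ℕ → (ℕ → Poly) → Poly
  sumTo zero    t = t zero
  sumTo (suc N) t = sumTo N t +ₚ t (suc N)

  -- For the operators used
  -- below (which lower degree by at least one) A^k f = 0 for k ≥ length f,
  -- so summing up to length f is the full (finite) series.
  expOp : Op → Op
  expOp A f = sumTo (length f) (λ k → inv (factC k) ·ₚ powOp A k f)

  fallC : Carrier → ℕ → Carrier
  fallC α zero    = 1#
  fallC α (suc m) = fallC α m * (α + - natC m)

  binomC : Carrier → ℕ → Carrier
  binomC α m = fallC α m * inv (factC m)

  -- (1 + B)^α f = Σ_m binom(α,m) B^m f  (finite for degree-lowering B)
  binomPowOp : Op → Carrier → Op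
  binomPowOp B α f = sumTo (length f) (λ m → binomC α m ·ₚ powOp B m f)

  L : ℕ → Op
  L p = expOp (negOp (xhat ∘ₒ powOp D (suc p)))

  Lα : ℕ → Carrier → Op
  Lα p α = binomPowOp (negOp (scaleOp (natC p) (powOp D p))) α ∘ₒ L p

  Rhs : ℕ → Carrier → Op
  Rhs p α = expOp (negOp (xhat ∘ₒ powOp D (suc p))
                   ⊕ negOp (scaleOp (α * natC p) (powOp D p)))

-- Every operator involved is a weighted shift of step p: the coefficient of x^i in A g is a
-- weight u(i) times the coefficient of x^(i+p) in g.  With R the weight of D^p, the operators
-- -pD^p, -x̂D^(p+1) and -x̂D^(p+1) - αpD^p have weights -R(i) times p, i and i + αp, so on both
-- sides the coefficient of x^i is a sum over K of the coefficient of x^(i+Kp) in f times products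
-- of weights.  Grouping the terms of (1 - pD^p)^α e^(-x̂D^(p+1)) with m + k = K, the identity
-- reduces to the scalar convolution
--   Σ_{m+k=K} binom(α,m) p^m (i+mp)(i+(m+1)p)⋯(i+(K-1)p) / k!  =  (i+αp)(i+αp+p)⋯(i+αp+(K-1)p) / K!,
-- which is the Chu–Vandermonde identity for factorials of step -p once each product on the left
-- is read backwards from i+(K-1)p.

module Submission where

open import Level using (Level)
open import Data.Nat using (ℕ; suc)
open import Defs

open import Data.Nat as ℕ using (zero; NonZero; s≤s)
import Data.Nat.Properties as ℕₚ
open import Data.List using ([]; _∷_; length)
open import Data.Sum using (inj₁; inj₂)
open import Relation.Binary.PropositionalEquality as ≡ using (_≡_)
open import Relation.Nullary using (¬_; yes; no)
open import Data.Maybe using (Maybe; just; nothing)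
import Relation.Binary.Reasoning.Setoid as SetoidReasoning
import Algebra.Properties.Semiring.Mult as SemiringMult
import Algebra.Properties.Semiring.Exp as SemiringExp
import Algebra.Properties.Ring as RingProperties
import Algebra.Properties.CommutativeSemigroup as CommutativeSemigroupProperties
import Algebra.Solver.Ring.NaturalCoefficients as NaturalCoefficients

module Disentangling {c ℓ : Level} (K : CharZeroField c ℓ) where
  open CharZeroField K hiding (zero)
  open Ops K
  open SetoidReasoning setoid
  open SemiringMult semiring using (_×_; ×-homo-+; ×1-homo-*)
  open SemiringExp semiring using (_^_)
  open RingProperties ring using (-‿distribˡ-*; -‿distribʳ-*)
  open CommutativeSemigroupProperties +-commutativeSemigroup using ()
    renaming (interchange to +-interchange; xy∙z≈xz∙y to xy+z≈xz+y)
  open CommutativeSemigroupProperties *-commutativeSemigroup using ()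
    renaming (interchange to *-interchange; x∙yz≈y∙xz to x*yz≈y*xz)

  private
    natC≡× : ∀ n → natC n ≡ n × 1#
    natC≡× zero    = ≡.refl
    natC≡× (suc n) = ≡.cong (1# +_) (natC≡× n)

    decide× : ∀ m n → Maybe (m × 1# ≈ n × 1#)
    decide× m n with m ℕ.≟ n
    ... | yes ≡.refl = just refl
    ... | no _       = nothing

  open NaturalCoefficients commutativeSemiring decide× using (solve; _:=_; _:+_; _:*_; con)

  natC-+ : ∀ m n → natC (m ℕ.+ n) ≈ natC m + natC n
  natC-+ m n = begin
    natC (m ℕ.+ n)          ≡⟨ natC≡× (m ℕ.+ n) ⟩
    (m ℕ.+ n) × 1#          ≈⟨ ×-homo-+ 1# m n ⟩
    m × 1# + n × 1#         ≡⟨ ≡.cong₂ _+_ (natC≡× m) (natC≡× n) ⟨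
    natC m + natC n         ∎

  natC-+-≡ : ∀ m n {k} → m ℕ.+ n ≡ k → natC m + natC n ≈ natC k
  natC-+-≡ m n ≡.refl = sym (natC-+ m n)

  natC-* : ∀ m n → natC (m ℕ.* n) ≈ natC m * natC n
  natC-* m n = begin
    natC (m ℕ.* n)          ≡⟨ natC≡× (m ℕ.* n) ⟩
    (m ℕ.* n) × 1#          ≈⟨ ×1-homo-* m n ⟩
    (m × 1#) * (n × 1#)     ≡⟨ ≡.cong₂ _*_ (natC≡× m) (natC≡× n) ⟨
    natC m * natC n         ∎

  x*y≈1⇒y≈inv-x : ∀ x y → ¬ x ≈ 0# → x * y ≈ 1# → y ≈ inv x
  x*y≈1⇒y≈inv-x x y x≉0 xy≈1 = begin
    y                 ≈⟨ *-identityʳ y ⟨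
    y * 1#            ≈⟨ *-congˡ (inv-right x x≉0) ⟨
    y * (x * inv x)   ≈⟨ *-assoc y x (inv x) ⟨
    (y * x) * inv x   ≈⟨ *-congʳ (trans (*-comm y x) xy≈1) ⟩
    1# * inv x        ≈⟨ *-identityˡ (inv x) ⟩
    inv x             ∎

  inv-1# : inv 1# ≈ 1#
  inv-1# = sym (x*y≈1⇒y≈inv-x 1# 1# 1≉0 (*-identityʳ 1#))

  *-cancelˡ-≉0 : ∀ x {y z} → ¬ x ≈ 0# → x * y ≈ x * z → y ≈ z
  *-cancelˡ-≉0 x {y} {z} x≉0 xy≈xz = begin
    y                   ≈⟨ *-identityˡ y ⟨
    1# * y              ≈⟨ *-congʳ inv-x*x≈1 ⟨
    (inv x * x) * y     ≈⟨ *-assoc (inv x) x y ⟩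
    inv x * (x * y)     ≈⟨ *-congˡ xy≈xz ⟩
    inv x * (x * z)     ≈⟨ *-assoc (inv x) x z ⟨
    (inv x * x) * z     ≈⟨ *-congʳ inv-x*x≈1 ⟩
    1# * z              ≈⟨ *-identityˡ z ⟩
    z                   ∎
    where
    inv-x*x≈1 : inv x * x ≈ 1#
    inv-x*x≈1 = trans (*-comm (inv x) x) (inv-right x x≉0)

  *-≉0 : ∀ {x y} → ¬ x ≈ 0# → ¬ y ≈ 0# → ¬ x * y ≈ 0#
  *-≉0 {x} {y} x≉0 y≉0 xy≈0 = y≉0 (*-cancelˡ-≉0 x x≉0 (trans xy≈0 (sym (zeroʳ x))))

  factC-≉0 : ∀ k → ¬ factC k ≈ 0#
  factC-≉0 zero    = 1≉0
  factC-≉0 (suc k) = *-≉0 (charZero k) (factC-≉0 k)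

  natC-suc*inv-factC-suc : ∀ k → natC (suc k) * inv (factC (suc k)) ≈ inv (factC k)
  natC-suc*inv-factC-suc k = x*y≈1⇒y≈inv-x (factC k) _ (factC-≉0 k) (begin
    factC k * (natC (suc k) * inv (factC (suc k)))   ≈⟨ *-assoc _ _ _ ⟨
    (factC k * natC (suc k)) * inv (factC (suc k))   ≈⟨ *-congʳ (*-comm _ _) ⟩
    factC (suc k) * inv (factC (suc k))              ≈⟨ inv-right _ (factC-≉0 (suc k)) ⟩
    1#                                               ∎)

  sum≤ : ℕ → (ℕ → Carrier) → Carrier
  sum≤ zero    h = h zero
  sum≤ (suc n) h = sum≤ n h + h (suc n)

  antidiagonalSum : ℕ → (ℕ → ℕ → Carrier) → Carrier
  antidiagonalSum zero    g = g zero zero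
  antidiagonalSum (suc K) g = g zero (suc K) + antidiagonalSum K (λ m k → g (suc m) k)

  sum≤-cong : ∀ n {h h′ : ℕ → Carrier} → (∀ k → h k ≈ h′ k) → sum≤ n h ≈ sum≤ n h′
  sum≤-cong zero    h≈h′ = h≈h′ zero
  sum≤-cong (suc n) h≈h′ = +-cong (sum≤-cong n h≈h′) (h≈h′ (suc n))

  sum≤-+ : ∀ n (g h : ℕ → Carrier) → sum≤ n (λ k → g k + h k) ≈ sum≤ n g + sum≤ n h
  sum≤-+ zero    g h = refl
  sum≤-+ (suc n) g h = begin
    sum≤ n (λ k → g k + h k) + (g (suc n) + h (suc n))  ≈⟨ +-congʳ (sum≤-+ n g h) ⟩
    (sum≤ n g + sum≤ n h) + (g (suc n) + h (suc n))     ≈⟨ +-interchange _ _ _ _ ⟩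
    (sum≤ n g + g (suc n)) + (sum≤ n h + h (suc n))     ∎

  *-distribˡ-sum≤ : ∀ n a (h : ℕ → Carrier) → a * sum≤ n h ≈ sum≤ n (λ k → a * h k)
  *-distribˡ-sum≤ zero    a h = refl
  *-distribˡ-sum≤ (suc n) a h = trans (distribˡ a (sum≤ n h) (h (suc n))) (+-congʳ (*-distribˡ-sum≤ n a h))

  sum≤-zero : ∀ n (h : ℕ → Carrier) → (∀ k → h k ≈ 0#) → sum≤ n h ≈ 0#
  sum≤-zero zero    h h≈0 = h≈0 zero
  sum≤-zero (suc n) h h≈0 = trans (+-cong (sum≤-zero n h h≈0) (h≈0 (suc n))) (+-identityʳ 0#)

  sum≤-shift : ∀ n (h : ℕ → Carrier) → sum≤ (suc n) h ≈ h zero + sum≤ n (λ k → h (suc k))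
  sum≤-shift zero    h = refl
  sum≤-shift (suc n) h = trans (+-congʳ (sum≤-shift n h)) (+-assoc _ _ _)

  sum≤-extend : ∀ {M} n (h : ℕ → Carrier) → (∀ k → M ℕ.< k → h k ≈ 0#) → M ℕ.≤ n →
                sum≤ n h ≈ sum≤ M h
  sum≤-extend n h h≈0 M≤n with ℕₚ.m≤n⇒m<n∨m≡n M≤n
  ... | inj₂ ≡.refl = refl
  sum≤-extend (suc n) h h≈0 _ | inj₁ (s≤s M≤n) =
    trans (+-cong (sum≤-extend n h h≈0 M≤n) (h≈0 (suc n) (s≤s M≤n))) (+-identityʳ _)

  sum≤-bound-irrelevant : ∀ M N (h : ℕ → Carrier) → (∀ k → M ℕ.< k → h k ≈ 0#) →
                          (∀ k → N ℕ.< k → h k ≈ 0#) → sum≤ M h ≈ sum≤ N h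
  sum≤-bound-irrelevant M N h h≈0₁ h≈0₂ with ℕₚ.≤-total M N
  ... | inj₁ M≤N = sym (sum≤-extend N h h≈0₁ M≤N)
  ... | inj₂ N≤M = sum≤-extend M h h≈0₂ N≤M

  antidiagonalSum-cong : ∀ K {g h : ℕ → ℕ → Carrier} → (∀ m k → m ℕ.+ k ≡ K → g m k ≈ h m k) →
                         antidiagonalSum K g ≈ antidiagonalSum K h
  antidiagonalSum-cong zero    g≈h = g≈h zero zero ≡.refl
  antidiagonalSum-cong (suc K) g≈h =
    +-cong (g≈h zero (suc K) ≡.refl) (antidiagonalSum-cong K (λ m k e → g≈h (suc m) k (≡.cong suc e)))

  antidiagonalSum-+ : ∀ K (g h : ℕ → ℕ → Carrier) →
    antidiagonalSum K (λ m k → g m k + h m k) ≈ antidiagonalSum K g + antidiagonalSum K h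
  antidiagonalSum-+ zero    g h = refl
  antidiagonalSum-+ (suc K) g h = begin
    (g 0 (suc K) + h 0 (suc K)) + antidiagonalSum K (λ m k → g (suc m) k + h (suc m) k)
      ≈⟨ +-congˡ (antidiagonalSum-+ K _ _) ⟩
    (g 0 (suc K) + h 0 (suc K)) + (antidiagonalSum K (λ m → g (suc m)) + antidiagonalSum K (λ m → h (suc m)))
      ≈⟨ +-interchange _ _ _ _ ⟩
    antidiagonalSum (suc K) g + antidiagonalSum (suc K) h ∎

  *-distribˡ-antidiagonalSum : ∀ K a (g : ℕ → ℕ → Carrier) →
    a * antidiagonalSum K g ≈ antidiagonalSum K (λ m k → a * g m k)
  *-distribˡ-antidiagonalSum zero    a g = refl
  *-distribˡ-antidiagonalSum (suc K) a g =
    trans (distribˡ a _ _) (+-congˡ (*-distribˡ-antidiagonalSum K a (λ m → g (suc m))))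

  antidiagonalSum-last : ∀ K (g : ℕ → ℕ → Carrier) →
    antidiagonalSum (suc K) g ≈ antidiagonalSum K (λ m k → g m (suc k)) + g (suc K) zero
  antidiagonalSum-last zero    g = refl
  antidiagonalSum-last (suc K) g =
    trans (+-congˡ (antidiagonalSum-last K (λ m → g (suc m)))) (sym (+-assoc _ _ _))

  sum≤-triangle : ∀ n (T : ℕ → ℕ → Carrier) → (∀ m k → n ℕ.< m ℕ.+ k → T m k ≈ 0#) →
    sum≤ n (λ m → sum≤ n (T m)) ≈ sum≤ n (λ K → antidiagonalSum K T)
  sum≤-triangle zero    T T≈0 = refl
  sum≤-triangle (suc n) T T≈0 = begin
    sum≤ (suc n) (λ m → sum≤ (suc n) (T m))
      ≈⟨ sum≤-shift n _ ⟩
    sum≤ (suc n) (T 0) + sum≤ n (λ m → sum≤ n (T (suc m)) + T (suc m) (suc n))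
      ≈⟨ +-congˡ (sum≤-cong n (λ m → trans (+-congˡ (T≈0 (suc m) (suc n) outside)) (+-identityʳ _))) ⟩
    sum≤ (suc n) (T 0) + sum≤ n (λ m → sum≤ n (T (suc m)))
      ≈⟨ +-congˡ (sum≤-triangle n (λ m → T (suc m)) (λ m k n<m+k → T≈0 (suc m) k (s≤s n<m+k))) ⟩
    sum≤ (suc n) (T 0) + sum≤ n (λ K → antidiagonalSum K (λ m → T (suc m)))
      ≈⟨ +-congʳ (sum≤-shift n (T 0)) ⟩
    (T 0 0 + sum≤ n (λ K → T 0 (suc K))) + sum≤ n (λ K → antidiagonalSum K (λ m → T (suc m)))
      ≈⟨ +-assoc _ _ _ ⟩
    T 0 0 + (sum≤ n (λ K → T 0 (suc K)) + sum≤ n (λ K → antidiagonalSum K (λ m → T (suc m))))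
      ≈⟨ +-congˡ (sum≤-+ n _ _) ⟨
    T 0 0 + sum≤ n (λ K → antidiagonalSum (suc K) T)
      ≈⟨ sum≤-shift n _ ⟨
    sum≤ (suc n) (λ K → antidiagonalSum K T) ∎
    where
    outside : ∀ {m} → suc n ℕ.< suc m ℕ.+ suc n
    outside {m} = s≤s (ℕₚ.m≤n+m (suc n) m)

  antidiagonalSum-natC-weighted : ∀ K (g : ℕ → ℕ → Carrier) →
    antidiagonalSum (suc K) (λ m k → (natC m + natC k) * g m k)
      ≈ antidiagonalSum K (λ m k → natC (suc m) * g (suc m) k)
        + antidiagonalSum K (λ m k → natC (suc k) * g m (suc k))
  antidiagonalSum-natC-weighted K g = begin
    antidiagonalSum (suc K) (λ m k → (natC m + natC k) * g m k)
      ≈⟨ antidiagonalSum-cong (suc K) (λ m k _ → distribʳ (g m k) (natC m) (natC k)) ⟩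
    antidiagonalSum (suc K) (λ m k → natC m * g m k + natC k * g m k)
      ≈⟨ antidiagonalSum-+ (suc K) (λ m k → natC m * g m k) (λ m k → natC k * g m k) ⟩
    antidiagonalSum (suc K) (λ m k → natC m * g m k) + antidiagonalSum (suc K) (λ m k → natC k * g m k)
      ≈⟨ +-congʳ (trans (+-congʳ (zeroˡ _)) (+-identityˡ _)) ⟩
    antidiagonalSum K (λ m k → natC (suc m) * g (suc m) k) + antidiagonalSum (suc K) (λ m k → natC k * g m k)
      ≈⟨ +-congˡ (trans (antidiagonalSum-last K (λ m k → natC k * g m k))
                        (trans (+-congˡ (zeroˡ _)) (+-identityʳ _))) ⟩
    antidiagonalSum K (λ m k → natC (suc m) * g (suc m) k)
      + antidiagonalSum K (λ m k → natC (suc k) * g m (suc k)) ∎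

  rising : Carrier → Carrier → ℕ → Carrier
  rising e y zero    = 1#
  rising e y (suc k) = y * rising e (y + e) k

  risingBinom : Carrier → Carrier → ℕ → Carrier
  risingBinom e y k = inv (factC k) * rising e y k

  module _ (e : Carrier) where

    rising-cong : ∀ {y y′} k → y ≈ y′ → rising e y k ≈ rising e y′ k
    rising-cong zero    y≈y′ = refl
    rising-cong (suc k) y≈y′ = *-cong y≈y′ (rising-cong k (+-congʳ y≈y′))

    rising-suc-last : ∀ y k → rising e y (suc k) ≈ rising e y k * (y + natC k * e)
    rising-suc-last y zero    = solve 2 (λ y e → y :* con 1 := con 1 :* (y :+ con 0 :* e)) refl y e
    rising-suc-last y (suc k) = begin
      y * rising e (y + e) (suc k)                             ≈⟨ *-congˡ (rising-suc-last (y + e) k) ⟩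
      y * (rising e (y + e) k * ((y + e) + natC k * e))        ≈⟨ *-assoc _ _ _ ⟨
      (y * rising e (y + e) k) * ((y + e) + natC k * e)        ≈⟨ *-congˡ (solve 3 (λ y e n →
                                                                   (y :+ e) :+ n :* e := y :+ (con 1 :+ n) :* e)
                                                                   refl y e (natC k)) ⟩
      rising e y (suc k) * (y + natC (suc k) * e)              ∎

    risingBinom-zero : ∀ y → risingBinom e y zero ≈ 1#
    risingBinom-zero y = trans (*-identityʳ (inv 1#)) inv-1#

    risingBinom-suc : ∀ y k →
      risingBinom e y k * (y + natC k * e) ≈ natC (suc k) * risingBinom e y (suc k)
    risingBinom-suc y k = begin
      (inv (factC k) * rising e y k) * (y + natC k * e)
        ≈⟨ *-assoc _ _ _ ⟩
      inv (factC k) * (rising e y k * (y + natC k * e))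
        ≈⟨ *-cong (natC-suc*inv-factC-suc k) (rising-suc-last y k) ⟨
      (natC (suc k) * inv (factC (suc k))) * rising e y (suc k)
        ≈⟨ *-assoc _ _ _ ⟩
      natC (suc k) * risingBinom e y (suc k) ∎

    risingBinom-*-suc : ∀ x y m k →
      (x + natC m * e + (y + natC k * e)) * (risingBinom e x m * risingBinom e y k)
        ≈ natC (suc m) * (risingBinom e x (suc m) * risingBinom e y k)
          + natC (suc k) * (risingBinom e x m * risingBinom e y (suc k))
    risingBinom-*-suc x y m k = begin
      (x + natC m * e + (y + natC k * e)) * (ρx m * ρy k)
        ≈⟨ solve 6 (λ a b u v x′ y′ → (x′ :+ y′) :* (u :* v) := (u :* x′) :* v :+ u :* (v :* y′))
             refl x y (ρx m) (ρy k) (x + natC m * e) (y + natC k * e) ⟩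
      (ρx m * (x + natC m * e)) * ρy k + ρx m * (ρy k * (y + natC k * e))
        ≈⟨ +-cong (*-congʳ (risingBinom-suc x m)) (*-congˡ (risingBinom-suc y k)) ⟩
      (natC (suc m) * ρx (suc m)) * ρy k + ρx m * (natC (suc k) * ρy (suc k))
        ≈⟨ +-cong (*-assoc _ _ _) (x*yz≈y*xz _ _ _) ⟩
      natC (suc m) * (ρx (suc m) * ρy k) + natC (suc k) * (ρx m * ρy (suc k)) ∎
      where
      ρx ρy : ℕ → Carrier
      ρx = risingBinom e x
      ρy = risingBinom e y

    risingBinom-vandermonde : ∀ K x y →
      risingBinom e (x + y) K ≈ antidiagonalSum K (λ m k → risingBinom e x m * risingBinom e y k)
    risingBinom-vandermonde zero    x y = begin
      risingBinom e (x + y) 0                   ≈⟨ risingBinom-zero (x + y) ⟩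
      1#                                        ≈⟨ *-identityˡ 1# ⟨
      1# * 1#                                   ≈⟨ *-cong (risingBinom-zero x) (risingBinom-zero y) ⟨
      risingBinom e x 0 * risingBinom e y 0     ∎
    risingBinom-vandermonde (suc K) x y = *-cancelˡ-≉0 (natC (suc K)) (charZero K) (begin
      natC (suc K) * risingBinom e (x + y) (suc K)
        ≈⟨ risingBinom-suc (x + y) K ⟨
      risingBinom e (x + y) K * (x + y + natC K * e)
        ≈⟨ trans (*-congʳ (risingBinom-vandermonde K x y)) (*-comm _ _) ⟩
      (x + y + natC K * e) * antidiagonalSum K (λ m k → ρx m * ρy k)
        ≈⟨ *-distribˡ-antidiagonalSum K _ _ ⟩
      antidiagonalSum K (λ m k → (x + y + natC K * e) * (ρx m * ρy k))
        ≈⟨ antidiagonalSum-cong K (λ m k m+k≡K →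
             trans (*-congʳ (split m k m+k≡K)) (risingBinom-*-suc x y m k)) ⟩
      antidiagonalSum K (λ m k → natC (suc m) * (ρx (suc m) * ρy k) + natC (suc k) * (ρx m * ρy (suc k)))
        ≈⟨ antidiagonalSum-+ K (λ m k → natC (suc m) * (ρx (suc m) * ρy k))
                               (λ m k → natC (suc k) * (ρx m * ρy (suc k))) ⟩
      antidiagonalSum K (λ m k → natC (suc m) * (ρx (suc m) * ρy k))
        + antidiagonalSum K (λ m k → natC (suc k) * (ρx m * ρy (suc k)))
        ≈⟨ antidiagonalSum-natC-weighted K (λ m k → ρx m * ρy k) ⟨
      antidiagonalSum (suc K) (λ m k → (natC m + natC k) * (ρx m * ρy k))
        ≈⟨ antidiagonalSum-cong (suc K) (λ m k m+k≡1+K → *-congʳ {ρx m * ρy k} (natC-+-≡ m k m+k≡1+K)) ⟩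
      antidiagonalSum (suc K) (λ m k → natC (suc K) * (ρx m * ρy k))
        ≈⟨ *-distribˡ-antidiagonalSum (suc K) (natC (suc K)) (λ m k → ρx m * ρy k) ⟨
      natC (suc K) * antidiagonalSum (suc K) (λ m k → ρx m * ρy k) ∎)
      where
      ρx ρy : ℕ → Carrier
      ρx = risingBinom e x
      ρy = risingBinom e y

      split : ∀ m k → m ℕ.+ k ≡ K → x + y + natC K * e ≈ x + natC m * e + (y + natC k * e)
      split m k m+k≡K = begin
        x + y + natC K * e                 ≈⟨ +-congˡ (*-congʳ (natC-+-≡ m k m+k≡K)) ⟨
        x + y + (natC m + natC k) * e      ≈⟨ solve 5 (λ x y a b e′ → x :+ y :+ (a :+ b) :* e′
                                                                  := x :+ a :* e′ :+ (y :+ b :* e′))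
                                                refl x y (natC m) (natC k) e ⟩
        x + natC m * e + (y + natC k * e)  ∎

  module _ (e : Carrier) where

    rising-reverse : ∀ k y → rising e y (suc k) ≈ rising (- e) (y + natC k * e) (suc k)
    rising-reverse zero    y = *-congʳ (sym (trans (+-congˡ (zeroˡ e)) (+-identityʳ y)))
    rising-reverse (suc k) y = begin
      y * rising e (y + e) (suc k)                       ≈⟨ *-congˡ (rising-reverse k (y + e)) ⟩
      y * rising (- e) ((y + e) + natC k * e) (suc k)    ≈⟨ *-congˡ (rising-cong (- e) (suc k) regroup) ⟩
      y * rising (- e) z (suc k)                         ≈⟨ *-comm _ _ ⟩
      rising (- e) z (suc k) * y                         ≈⟨ *-congˡ y≈z-[1+k]e ⟩
      rising (- e) z (suc k) * (z + natC (suc k) * - e)  ≈⟨ rising-suc-last (- e) z (suc k) ⟨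
      rising (- e) z (suc (suc k))                       ∎
      where
      n = natC (suc k)
      z = y + n * e
      regroup : (y + e) + natC k * e ≈ z
      regroup = solve 3 (λ y e m → (y :+ e) :+ m :* e := y :+ (con 1 :+ m) :* e) refl y e (natC k)
      y≈z-[1+k]e : y ≈ z + n * - e
      y≈z-[1+k]e = sym (begin
        (y + n * e) + n * - e     ≈⟨ +-congˡ (-‿distribʳ-* n e) ⟨
        (y + n * e) + - (n * e)   ≈⟨ +-assoc _ _ _ ⟩
        y + (n * e + - (n * e))   ≈⟨ +-congˡ (-‿inverseʳ _) ⟩
        y + 0#                    ≈⟨ +-identityʳ y ⟩
        y                         ∎)

    risingBinom-reverse-on-antidiagonal : ∀ K m k → m ℕ.+ k ≡ suc K → ∀ c →
      risingBinom e (c + natC m * e) k ≈ risingBinom (- e) (c + natC K * e) k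
    risingBinom-reverse-on-antidiagonal K m zero    _       c = refl
    risingBinom-reverse-on-antidiagonal K m (suc k) m+1+k≡1+K c = *-congˡ (begin
      rising e (c + natC m * e) (suc k)                    ≈⟨ rising-reverse k _ ⟩
      rising (- e) (c + natC m * e + natC k * e) (suc k)   ≈⟨ rising-cong (- e) (suc k) regroup ⟩
      rising (- e) (c + natC K * e) (suc k)                ∎)
      where
      m+k≡K : m ℕ.+ k ≡ K
      m+k≡K = ℕₚ.suc-injective (≡.trans (≡.sym (ℕₚ.+-suc m k)) m+1+k≡1+K)
      regroup : c + natC m * e + natC k * e ≈ c + natC K * e
      regroup = begin
        c + natC m * e + natC k * e   ≈⟨ solve 4 (λ c a b e′ → c :+ a :* e′ :+ b :* e′ := c :+ (a :+ b) :* e′)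
                                               refl c (natC m) (natC k) e ⟩
        c + (natC m + natC k) * e     ≈⟨ +-congˡ (*-congʳ (natC-+-≡ m k m+k≡K)) ⟩
        c + natC K * e                ∎

    -- Read backwards, every rising factorial on the antidiagonal m + k = K + 1 starts at c + K e,
    -- so the identity is Vandermonde for the step - e.
    risingBinom-convolution : ∀ K c x →
      antidiagonalSum K (λ m k → risingBinom (- e) x m * risingBinom e (c + natC m * e) k)
        ≈ risingBinom e (c + x) K
    risingBinom-convolution zero    c x = begin
      risingBinom (- e) x 0 * risingBinom e (c + 0# * e) 0
        ≈⟨ *-cong (risingBinom-zero (- e) x) (risingBinom-zero e (c + 0# * e)) ⟩
      1# * 1#                    ≈⟨ *-identityˡ 1# ⟩
      1#                         ≈⟨ risingBinom-zero e (c + x) ⟨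
      risingBinom e (c + x) 0    ∎
    risingBinom-convolution (suc K) c x = begin
      antidiagonalSum (suc K) (λ m k → risingBinom (- e) x m * risingBinom e (c + natC m * e) k)
        ≈⟨ antidiagonalSum-cong (suc K) (λ m k m+k≡1+K →
             *-congˡ {risingBinom (- e) x m} (risingBinom-reverse-on-antidiagonal K m k m+k≡1+K c)) ⟩
      antidiagonalSum (suc K) (λ m k → risingBinom (- e) x m * risingBinom (- e) y k)
        ≈⟨ risingBinom-vandermonde (- e) (suc K) x y ⟨
      risingBinom (- e) (x + y) (suc K)
        ≈⟨ *-congˡ (rising-cong (- e) (suc K) (sym (+-assoc _ _ _))) ⟩
      risingBinom (- e) ((x + c) + natC K * e) (suc K)
        ≈⟨ *-congˡ (rising-cong (- e) (suc K) (+-congʳ (+-comm x c))) ⟩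
      risingBinom (- e) ((c + x) + natC K * e) (suc K)
        ≈⟨ *-congˡ (rising-reverse K (c + x)) ⟨
      risingBinom e (c + x) (suc K) ∎
      where
      y = c + natC K * e

  fallC*^≈rising : ∀ α d m → fallC α m * d ^ m ≈ rising (- d) (α * d) m
  fallC*^≈rising α d zero    = *-identityʳ 1#
  fallC*^≈rising α d (suc m) = begin
    (fallC α m * (α + - natC m)) * (d * d ^ m)     ≈⟨ solve 4 (λ F a d P → (F :* a) :* (d :* P) := (F :* P) :* (a :* d))
                                                           refl (fallC α m) (α + - natC m) d (d ^ m) ⟩
    (fallC α m * d ^ m) * ((α + - natC m) * d)     ≈⟨ *-cong (fallC*^≈rising α d m) factor ⟩
    rising (- d) (α * d) m * (α * d + natC m * - d) ≈⟨ rising-suc-last (- d) (α * d) m ⟨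
    rising (- d) (α * d) (suc m)                   ∎
    where
    factor : (α + - natC m) * d ≈ α * d + natC m * - d
    factor = begin
      (α + - natC m) * d       ≈⟨ distribʳ d α (- natC m) ⟩
      α * d + - natC m * d     ≈⟨ +-congˡ (trans (sym (-‿distribˡ-* (natC m) d)) (-‿distribʳ-* (natC m) d)) ⟩
      α * d + natC m * - d     ∎

  binomC*^≈risingBinom : ∀ α d m → binomC α m * d ^ m ≈ risingBinom (- d) (α * d) m
  binomC*^≈risingBinom α d m = begin
    (fallC α m * inv (factC m)) * d ^ m     ≈⟨ solve 3 (λ F I P → (F :* I) :* P := I :* (F :* P))
                                                    refl (fallC α m) (inv (factC m)) (d ^ m) ⟩
    inv (factC m) * (fallC α m * d ^ m)     ≈⟨ *-congˡ (fallC*^≈rising α d m) ⟩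
    risingBinom (- d) (α * d) m             ∎

  coeff-+ₚ : ∀ f g i → coeff (f +ₚ g) i ≈ coeff f i + coeff g i
  coeff-+ₚ []      g       i       = sym (+-identityˡ _)
  coeff-+ₚ (a ∷ f) []      i       = sym (+-identityʳ _)
  coeff-+ₚ (a ∷ f) (b ∷ g) zero    = refl
  coeff-+ₚ (a ∷ f) (b ∷ g) (suc i) = coeff-+ₚ f g i

  coeff-·ₚ : ∀ k f i → coeff (k ·ₚ f) i ≈ k * coeff f i
  coeff-·ₚ k []      i       = sym (zeroʳ k)
  coeff-·ₚ k (a ∷ f) zero    = refl
  coeff-·ₚ k (a ∷ f) (suc i) = coeff-·ₚ k f i

  coeff-sumTo : ∀ n t i → coeff (sumTo n t) i ≈ sum≤ n (λ k → coeff (t k) i)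
  coeff-sumTo zero    t i = refl
  coeff-sumTo (suc n) t i = trans (coeff-+ₚ (sumTo n t) (t (suc n)) i) (+-congʳ (coeff-sumTo n t i))

  DegreeBelow : ℕ → Poly → Set ℓ
  DegreeBelow n g = ∀ j → n ℕ.≤ j → coeff g j ≈ 0#

  length-degreeBelow : ∀ g → DegreeBelow (length g) g
  length-degreeBelow []      j       _         = refl
  length-degreeBelow (a ∷ g) (suc j) (s≤s n≤j) = length-degreeBelow g j n≤j

  -- D is defined through a private helper; this meta is solved by unification with the body
  -- of D, and abstracting the literal 1 makes the solution general in the starting index.
  mutual
    derivFrom : ℕ → Poly → Poly
    derivFrom = _

    D-∷ : ∀ a f → D (a ∷ f) ≡ derivFrom 1 f
    D-∷ a f with 1
    ... | n = ≡.refl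

  coeff-derivFrom : ∀ n f i → coeff (derivFrom n f) i ≈ natC (n ℕ.+ i) * coeff f i
  coeff-derivFrom n []      i       = sym (zeroʳ _)
  coeff-derivFrom n (a ∷ f) zero    = *-congʳ (reflexive (≡.cong natC (≡.sym (ℕₚ.+-identityʳ n))))
  coeff-derivFrom n (a ∷ f) (suc i) =
    trans (coeff-derivFrom (suc n) f i) (*-congʳ (reflexive (≡.cong natC (≡.sym (ℕₚ.+-suc n i)))))

  record IsWeightedShift (s : ℕ) (u : ℕ → Carrier) (A : Op) : Set (c Level.⊔ ℓ) where
    constructor weightedShift
    field coeff-shift : ∀ g i → coeff (A g) i ≈ u i * coeff g (s ℕ.+ i)
  open IsWeightedShift

  weightedShift-cong : ∀ {s u v A} → (∀ i → u i ≈ v i) → IsWeightedShift s u A → IsWeightedShift s v A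
  weightedShift-cong u≈v A-shift = weightedShift λ g i → trans (coeff-shift A-shift g i) (*-congʳ (u≈v i))

  D-weightedShift : IsWeightedShift 1 (λ i → natC (suc i)) D
  D-weightedShift = weightedShift λ where
    []      i → sym (zeroʳ _)
    (a ∷ f) i → coeff-derivFrom 1 f i

  ∘-weightedShift : ∀ {s t u v A B} → IsWeightedShift s u A → IsWeightedShift t v B →
                    IsWeightedShift (s ℕ.+ t) (λ i → u i * v (s ℕ.+ i)) (A ∘ₒ B)
  ∘-weightedShift {s} {t} {u} {v} {A} {B} A-shift B-shift = weightedShift λ g i → begin
    coeff (A (B g)) i                                  ≈⟨ coeff-shift A-shift (B g) i ⟩
    u i * coeff (B g) (s ℕ.+ i)                        ≈⟨ *-congˡ (coeff-shift B-shift g (s ℕ.+ i)) ⟩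
    u i * (v (s ℕ.+ i) * coeff g (t ℕ.+ (s ℕ.+ i)))    ≈⟨ *-assoc _ _ _ ⟨
    (u i * v (s ℕ.+ i)) * coeff g (t ℕ.+ (s ℕ.+ i))    ≈⟨ *-congˡ (reflexive (≡.cong (coeff g) (index i))) ⟩
    (u i * v (s ℕ.+ i)) * coeff g ((s ℕ.+ t) ℕ.+ i)    ∎
    where
    index : ∀ i → t ℕ.+ (s ℕ.+ i) ≡ (s ℕ.+ t) ℕ.+ i
    index i = ≡.trans (≡.sym (ℕₚ.+-assoc t s i)) (≡.cong (ℕ._+ i) (ℕₚ.+-comm t s))

  weightProd : (ℕ → Carrier) → ℕ → ℕ → ℕ → Carrier
  weightProd u s zero    i = 1#
  weightProd u s (suc k) i = u i * weightProd u s k (s ℕ.+ i)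

  powOp-weightedShift : ∀ {s u A} → IsWeightedShift s u A → ∀ k →
                        IsWeightedShift (k ℕ.* s) (weightProd u s k) (powOp A k)
  powOp-weightedShift A-shift zero    = weightedShift λ g i → sym (*-identityˡ _)
  powOp-weightedShift A-shift (suc k) = ∘-weightedShift A-shift (powOp-weightedShift A-shift k)

  scaleOp-weightedShift : ∀ {s u A} k → IsWeightedShift s u A → IsWeightedShift s (λ i → k * u i) (scaleOp k A)
  scaleOp-weightedShift {A = A} k A-shift = weightedShift λ g i →
    trans (coeff-·ₚ k (A g) i) (trans (*-congˡ (coeff-shift A-shift g i)) (sym (*-assoc _ _ _)))

  ⊕-weightedShift : ∀ {s u v A B} → IsWeightedShift s u A → IsWeightedShift s v B →
                    IsWeightedShift s (λ i → u i + v i) (A ⊕ B)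
  ⊕-weightedShift {A = A} {B} A-shift B-shift = weightedShift λ g i →
    trans (coeff-+ₚ (A g) (B g) i)
      (trans (+-cong (coeff-shift A-shift g i) (coeff-shift B-shift g i)) (sym (distribʳ _ _ _)))

  x̂D∘-weightedShift : ∀ {s u A} → IsWeightedShift s u A →
                      IsWeightedShift s (λ i → natC i * u i) (xhat ∘ₒ (D ∘ₒ A))
  x̂D∘-weightedShift {s} {u} {A} A-shift = weightedShift λ where
    g zero    → sym (trans (*-congʳ (zeroˡ _)) (zeroˡ _))
    g (suc i) → begin
      coeff (D (A g)) i                                   ≈⟨ coeff-shift D-weightedShift (A g) i ⟩
      natC (suc i) * coeff (A g) (suc i)                  ≈⟨ *-congˡ (coeff-shift A-shift g (suc i)) ⟩
      natC (suc i) * (u (suc i) * coeff g (s ℕ.+ suc i))  ≈⟨ *-assoc _ _ _ ⟨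
      (natC (suc i) * u (suc i)) * coeff g (s ℕ.+ suc i)  ∎

  module _ (s : ℕ) where

    weightProd-* : ∀ u v k i →
      weightProd (λ j → u j * v j) s k i ≈ weightProd u s k i * weightProd v s k i
    weightProd-* u v zero    i = sym (*-identityˡ 1#)
    weightProd-* u v (suc k) i = trans (*-congˡ (weightProd-* u v k (s ℕ.+ i))) (*-interchange _ _ _ _)

    weightProd-const : ∀ a k i → weightProd (λ _ → a) s k i ≈ a ^ k
    weightProd-const a zero    i = refl
    weightProd-const a (suc k) i = *-congˡ (weightProd-const a k (s ℕ.+ i))

    weightProd-+ : ∀ u m k i →
      weightProd u s (m ℕ.+ k) i ≈ weightProd u s m i * weightProd u s k (m ℕ.* s ℕ.+ i)
    weightProd-+ u zero    k i = sym (*-identityˡ _)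
    weightProd-+ u (suc m) k i = begin
      u i * weightProd u s (m ℕ.+ k) (s ℕ.+ i)
        ≈⟨ *-congˡ (weightProd-+ u m k (s ℕ.+ i)) ⟩
      u i * (weightProd u s m (s ℕ.+ i) * weightProd u s k (m ℕ.* s ℕ.+ (s ℕ.+ i)))
        ≈⟨ *-assoc _ _ _ ⟨
      weightProd u s (suc m) i * weightProd u s k (m ℕ.* s ℕ.+ (s ℕ.+ i))
        ≈⟨ *-congˡ (reflexive (≡.cong (weightProd u s k) index)) ⟩
      weightProd u s (suc m) i * weightProd u s k (suc m ℕ.* s ℕ.+ i) ∎
      where
      index : m ℕ.* s ℕ.+ (s ℕ.+ i) ≡ (s ℕ.+ m ℕ.* s) ℕ.+ i
      index = ≡.trans (≡.sym (ℕₚ.+-assoc (m ℕ.* s) s i)) (≡.cong (ℕ._+ i) (ℕₚ.+-comm (m ℕ.* s) s))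

    weightProd-arithmetic : ∀ {u} a → (∀ j → u (s ℕ.+ j) ≈ u j + a) →
                            ∀ k i → weightProd u s k i ≈ rising a (u i) k
    weightProd-arithmetic a u-step zero    i = refl
    weightProd-arithmetic a u-step (suc k) i =
      *-congˡ (trans (weightProd-arithmetic a u-step k (s ℕ.+ i)) (rising-cong a k (u-step i)))

  -- expOp A and binomPowOp A β are, by definition, powerSeriesOp (λ k → inv (factC k)) A
  -- and powerSeriesOp (binomC β) A.
  powerSeriesOp : (ℕ → Carrier) → Op → Op
  powerSeriesOp a A f = sumTo (length f) (λ k → a k ·ₚ powOp A k f)

  module _ {s u A} .{{_ : NonZero s}} (A-shift : IsWeightedShift s u A) (a : ℕ → Carrier) where

    coeff-powerSeriesOp : ∀ {n} g → DegreeBelow n g → ∀ i →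
      coeff (powerSeriesOp a A g) i ≈ sum≤ n (λ k → (a k * weightProd u s k i) * coeff g (k ℕ.* s ℕ.+ i))
    coeff-powerSeriesOp {n} g g<n i = begin
      coeff (powerSeriesOp a A g) i
        ≈⟨ coeff-sumTo (length g) _ i ⟩
      sum≤ (length g) (λ k → coeff (a k ·ₚ powOp A k g) i)
        ≈⟨ sum≤-cong (length g) (λ k → trans (coeff-·ₚ (a k) (powOp A k g) i)
             (trans (*-congˡ (coeff-shift (powOp-weightedShift A-shift k) g i)) (sym (*-assoc _ _ _)))) ⟩
      sum≤ (length g) term
        ≈⟨ sum≤-bound-irrelevant (length g) n term (vanishes (length-degreeBelow g)) (vanishes g<n) ⟩
      sum≤ n term ∎
      where
      term : ℕ → Carrier
      term k = (a k * weightProd u s k i) * coeff g (k ℕ.* s ℕ.+ i)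
      vanishes : ∀ {N} → DegreeBelow N g → ∀ k → N ℕ.< k → term k ≈ 0#
      vanishes g<N k N<k = trans (*-congˡ (g<N _ N≤ks+i)) (zeroʳ _)
        where
        N≤ks+i = ℕₚ.≤-trans (ℕₚ.<⇒≤ N<k) (ℕₚ.≤-trans (ℕₚ.m≤m*n k s) (ℕₚ.m≤m+n (k ℕ.* s) i))

    powerSeriesOp-degreeBelow : ∀ {n} g → DegreeBelow n g → DegreeBelow n (powerSeriesOp a A g)
    powerSeriesOp-degreeBelow {n} g g<n j n≤j =
      trans (coeff-powerSeriesOp g g<n j)
        (sum≤-zero n _ (λ k → trans (*-congˡ (g<n _ (ℕₚ.≤-trans n≤j (ℕₚ.m≤n+m j (k ℕ.* s))))) (zeroʳ _)))

  coeff-powerSeriesOp-∘ : ∀ {s u v A B} .{{_ : NonZero s}} →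
    IsWeightedShift s u A → IsWeightedShift s v B → ∀ a b {n} f → DegreeBelow n f → ∀ i →
    coeff (powerSeriesOp a A (powerSeriesOp b B f)) i
      ≈ sum≤ n (λ K → antidiagonalSum K (λ m k → (a m * weightProd u s m i)
                                                  * (b k * weightProd v s k (m ℕ.* s ℕ.+ i)))
                        * coeff f (K ℕ.* s ℕ.+ i))
  coeff-powerSeriesOp-∘ {s} {u} {v} {A} {B} A-shift B-shift a b {n} f f<n i = begin
    coeff (powerSeriesOp a A (powerSeriesOp b B f)) i
      ≈⟨ coeff-powerSeriesOp A-shift a (powerSeriesOp b B f) (powerSeriesOp-degreeBelow B-shift b f f<n) i ⟩
    sum≤ n (λ m → P m * coeff (powerSeriesOp b B f) (m ℕ.* s ℕ.+ i))
      ≈⟨ sum≤-cong n (λ m → *-congˡ (coeff-powerSeriesOp B-shift b f f<n (m ℕ.* s ℕ.+ i))) ⟩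
    sum≤ n (λ m → P m * sum≤ n (λ k → Q m k * coeff f (k ℕ.* s ℕ.+ (m ℕ.* s ℕ.+ i))))
      ≈⟨ sum≤-cong n (λ m → *-distribˡ-sum≤ n (P m) _) ⟩
    sum≤ n (λ m → sum≤ n (T m))
      ≈⟨ sum≤-triangle n T T-vanishes ⟩
    sum≤ n (λ K → antidiagonalSum K T)
      ≈⟨ sum≤-cong n (λ K → antidiagonalSum-cong K (T-on-antidiagonal K)) ⟩
    sum≤ n (λ K → antidiagonalSum K (λ m k → coeff f (K ℕ.* s ℕ.+ i) * (P m * Q m k)))
      ≈⟨ sum≤-cong n (λ K → trans (sym (*-distribˡ-antidiagonalSum K _ (λ m k → P m * Q m k))) (*-comm _ _)) ⟩
    sum≤ n (λ K → antidiagonalSum K (λ m k → P m * Q m k) * coeff f (K ℕ.* s ℕ.+ i)) ∎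
    where
    P : ℕ → Carrier
    P m = a m * weightProd u s m i
    Q : ℕ → ℕ → Carrier
    Q m k = b k * weightProd v s k (m ℕ.* s ℕ.+ i)
    T : ℕ → ℕ → Carrier
    T m k = P m * (Q m k * coeff f (k ℕ.* s ℕ.+ (m ℕ.* s ℕ.+ i)))

    index : ∀ m k → k ℕ.* s ℕ.+ (m ℕ.* s ℕ.+ i) ≡ (m ℕ.+ k) ℕ.* s ℕ.+ i
    index m k = ≡.trans (≡.sym (ℕₚ.+-assoc (k ℕ.* s) (m ℕ.* s) i))
                  (≡.cong (ℕ._+ i) (≡.trans (ℕₚ.+-comm (k ℕ.* s) (m ℕ.* s)) (≡.sym (ℕₚ.*-distribʳ-+ s m k))))

    T-vanishes : ∀ m k → n ℕ.< m ℕ.+ k → T m k ≈ 0#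
    T-vanishes m k n<m+k = trans (*-congˡ (trans (*-congˡ (f<n _ n≤index)) (zeroʳ _))) (zeroʳ _)
      where
      n≤index = ℕₚ.≤-trans (ℕₚ.<⇒≤ n<m+k)
                  (ℕₚ.≤-trans (ℕₚ.m≤m*n (m ℕ.+ k) s)
                    (ℕₚ.≤-trans (ℕₚ.m≤m+n _ i) (ℕₚ.≤-reflexive (≡.sym (index m k)))))

    T-on-antidiagonal : ∀ K m k → m ℕ.+ k ≡ K → T m k ≈ coeff f (K ℕ.* s ℕ.+ i) * (P m * Q m k)
    T-on-antidiagonal K m k ≡.refl = begin
      P m * (Q m k * coeff f (k ℕ.* s ℕ.+ (m ℕ.* s ℕ.+ i)))   ≈⟨ *-assoc _ _ _ ⟨
      (P m * Q m k) * coeff f (k ℕ.* s ℕ.+ (m ℕ.* s ℕ.+ i))   ≈⟨ *-comm _ _ ⟩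
      coeff f (k ℕ.* s ℕ.+ (m ℕ.* s ℕ.+ i)) * (P m * Q m k)   ≈⟨ *-congʳ (reflexive (≡.cong (coeff f) (index m k))) ⟩
      coeff f ((m ℕ.+ k) ℕ.* s ℕ.+ i) * (P m * Q m k)         ∎

  module _ (p : ℕ) (α : Carrier) (w : ℕ → Carrier) where
    private
      d : Carrier
      d = natC p

      natC-shift : ∀ j → natC (p ℕ.+ j) ≈ natC j + d
      natC-shift j = trans (natC-+ p j) (+-comm d (natC j))

      natC+αd-shift : ∀ j → natC (p ℕ.+ j) + α * d ≈ (natC j + α * d) + d
      natC+αd-shift j = trans (+-congʳ (natC-shift j)) (xy+z≈xz+y _ _ _)

    binomial-exp-convolution : ∀ K i →
      antidiagonalSum K (λ m k → (binomC α m * weightProd (λ j → d * w j) p m i)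
                                 * (inv (factC k) * weightProd (λ j → natC j * w j) p k (m ℕ.* p ℕ.+ i)))
        ≈ inv (factC K) * weightProd (λ j → (natC j + α * d) * w j) p K i
    binomial-exp-convolution K i = begin
      antidiagonalSum K (λ m k → (binomC α m * weightProd (λ j → d * w j) p m i)
                                 * (inv (factC k) * weightProd (λ j → natC j * w j) p k (m ℕ.* p ℕ.+ i)))
        ≈⟨ antidiagonalSum-cong K term-on-antidiagonal ⟩
      antidiagonalSum K (λ m k → W K i * (risingBinom (- d) (α * d) m * risingBinom d (natC i + natC m * d) k))
        ≈⟨ *-distribˡ-antidiagonalSum K (W K i) _ ⟨
      W K i * antidiagonalSum K (λ m k → risingBinom (- d) (α * d) m * risingBinom d (natC i + natC m * d) k)
        ≈⟨ *-congˡ (risingBinom-convolution d K (natC i) (α * d)) ⟩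
      W K i * (inv (factC K) * rising d (natC i + α * d) K)
        ≈⟨ x*yz≈y*xz _ _ _ ⟩
      inv (factC K) * (W K i * rising d (natC i + α * d) K)
        ≈⟨ *-congˡ (trans (*-congʳ (weightProd-arithmetic p d natC+αd-shift K i)) (*-comm _ _)) ⟨
      inv (factC K) * (weightProd (λ j → natC j + α * d) p K i * W K i)
        ≈⟨ *-congˡ (weightProd-* p (λ j → natC j + α * d) w K i) ⟨
      inv (factC K) * weightProd (λ j → (natC j + α * d) * w j) p K i ∎
      where
      W : ℕ → ℕ → Carrier
      W = weightProd w p

      natC-index : ∀ m → natC (m ℕ.* p ℕ.+ i) ≈ natC i + natC m * d
      natC-index m = trans (natC-+ (m ℕ.* p) i) (trans (+-congʳ (natC-* m p)) (+-comm _ _))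

      term-on-antidiagonal : ∀ m k → m ℕ.+ k ≡ K →
        (binomC α m * weightProd (λ j → d * w j) p m i)
          * (inv (factC k) * weightProd (λ j → natC j * w j) p k (m ℕ.* p ℕ.+ i))
          ≈ W K i * (risingBinom (- d) (α * d) m * risingBinom d (natC i + natC m * d) k)
      term-on-antidiagonal m k ≡.refl = begin
        (binomC α m * weightProd (λ j → d * w j) p m i) * (inv (factC k) * weightProd (λ j → natC j * w j) p k j)
          ≈⟨ *-cong (*-congˡ (trans (weightProd-* p (λ _ → d) w m i) (*-congʳ (weightProd-const p d m i))))
                    (*-congˡ (weightProd-* p natC w k j)) ⟩
        (binomC α m * (d ^ m * W m i)) * (inv (factC k) * (weightProd natC p k j * W k j))
          ≈⟨ solve 6 (λ b P Wm I N Wk → (b :* (P :* Wm)) :* (I :* (N :* Wk)) := (Wm :* Wk) :* ((b :* P) :* (I :* N)))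
               refl (binomC α m) (d ^ m) (W m i) (inv (factC k)) (weightProd natC p k j) (W k j) ⟩
        (W m i * W k j) * ((binomC α m * d ^ m) * (inv (factC k) * weightProd natC p k j))
          ≈⟨ *-cong (weightProd-+ p w m k i) (sym (*-cong (binomC*^≈risingBinom α d m) (*-congˡ N-prod))) ⟨
        W (m ℕ.+ k) i * (risingBinom (- d) (α * d) m * risingBinom d (natC i + natC m * d) k) ∎
        where
        j = m ℕ.* p ℕ.+ i
        N-prod : weightProd natC p k j ≈ rising d (natC i + natC m * d) k
        N-prod = trans (weightProd-arithmetic p d natC-shift k j)
                       (rising-cong d k (natC-index m))

  module Operators (p : ℕ) (α : Carrier) where

    Dᵖ-weight : ℕ → Carrier
    Dᵖ-weight = weightProd (λ i → natC (suc i)) 1 p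

    -Dᵖ-weight : ℕ → Carrier
    -Dᵖ-weight i = - 1# * Dᵖ-weight i

    Dᵖ-weightedShift : IsWeightedShift p Dᵖ-weight (powOp D p)
    Dᵖ-weightedShift = ≡.subst (λ s → IsWeightedShift s Dᵖ-weight (powOp D p)) (ℕₚ.*-identityʳ p)
                         (powOp-weightedShift D-weightedShift p)

    -pDᵖ-weightedShift : IsWeightedShift p (λ j → natC p * -Dᵖ-weight j) (negOp (scaleOp (natC p) (powOp D p)))
    -pDᵖ-weightedShift = weightedShift-cong (λ j → x*yz≈y*xz _ _ _)
      (scaleOp-weightedShift (- 1#) (scaleOp-weightedShift (natC p) Dᵖ-weightedShift))

    -x̂Dᵖ⁺¹-weightedShift : IsWeightedShift p (λ j → natC j * -Dᵖ-weight j) (negOp (xhat ∘ₒ powOp D (suc p)))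
    -x̂Dᵖ⁺¹-weightedShift = weightedShift-cong (λ j → x*yz≈y*xz _ _ _)
      (scaleOp-weightedShift (- 1#) (x̂D∘-weightedShift Dᵖ-weightedShift))

    -x̂Dᵖ⁺¹-αpDᵖ-weightedShift :
      IsWeightedShift p (λ j → (natC j + α * natC p) * -Dᵖ-weight j)
        (negOp (xhat ∘ₒ powOp D (suc p)) ⊕ negOp (scaleOp (α * natC p) (powOp D p)))
    -x̂Dᵖ⁺¹-αpDᵖ-weightedShift =
      weightedShift-cong (λ j → trans (+-congˡ (x*yz≈y*xz _ _ _)) (sym (distribʳ _ _ _)))
      (⊕-weightedShift -x̂Dᵖ⁺¹-weightedShift
        (scaleOp-weightedShift (- 1#) (scaleOp-weightedShift (α * natC p) Dᵖ-weightedShift)))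

mainTheorem18 : ∀ {c ℓ : Level} (K : CharZeroField c ℓ) →
    let open Ops K in
    (q : ℕ) (α : CharZeroField.Carrier K) (f : Poly) →
    Lα (suc q) α f ≈ₚ Rhs (suc q) α f
mainTheorem18 K q α f i =
  trans (coeff-powerSeriesOp-∘ -pDᵖ-weightedShift -x̂Dᵖ⁺¹-weightedShift _ _ f (length-degreeBelow f) i)
    (trans (sum≤-cong (length f) (λ N → *-congʳ (binomial-exp-convolution p α -Dᵖ-weight N i)))
      (sym (coeff-powerSeriesOp -x̂Dᵖ⁺¹-αpDᵖ-weightedShift _ f (length-degreeBelow f) i)))
  where
  open CharZeroField K hiding (zero)
  open Disentangling K
  p = suc q
  open Operators p α
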